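{- Let $\Sigma$ be a finite simplicial complex, let $G$ be a finite group acting on it by simplicial automorphisms, and let $k$ be the number of $G$-orbits of vertices of $\Sigma$. If $k\le\dim(\Sigma)$, then the action of $G$ on $\Sigma$ is not translative.
   Context: The action is translative if for every $g\in G$ and every face $\sigma$, whenever there is a face of $\Sigma$ containing both $\sigma$ and $g\sigma$, then $g\sigma=\sigma$. -}

module Defs where

open import Level using (Level; _⊔_)
open import Data.Nat using (ℕ; zero; suc)
open import Data.Bool using (Bool; true; false; _∧_; _∨_)
open import Data.Fin using (Fin; _≟_)
open import Data.Fin.Subset using (Subset; _⊆_; ⁅_⁆; ∣_∣)
open import Data.Vec using (Vec; []; _∷_; lookup; tabulate)
open import Data.List using (List; []; _∷_; _++_; map; allFin; foldr)
open import Data.Bool.ListAction using (any)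
open import Data.List.Relation.Unary.Any using (Any)
open import Data.Integer using (ℤ; +_; -[1+_]) renaming (_-_ to _-ℤ_; _⊔_ to _⊔ℤ_)
open import Data.Product using (Σ; ∃; _×_)
open import Function.Bundles using (_⇔_)
open import Relation.Nullary.Decidable using (⌊_⌋)
open import Relation.Binary.PropositionalEquality using (_≡_)
open import Algebra.Bundles using (Group)

allSubsets : (n : ℕ) → List (Subset n)
allSubsets zero = [] ∷ []
allSubsets (suc n) = map (true ∷_) (allSubsets n) ++ map (false ∷_) (allSubsets n)

-- Faces are given by a decidable (Bool) predicate on subsets of Fin n;
-- the family is closed under taking subsets and every vertex is a face,
-- so the vertex set of the complex is exactly Fin n.
record SimplicialComplex (n : ℕ) : Set where
  field
    isFace      : Subset n → Bool
    down-closed : ∀ {σ τ} → isFace σ ≡ true → τ ⊆ σ → isFace τ ≡ true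
    vertex      : ∀ v → isFace ⁅ v ⁆ ≡ true
open SimplicialComplex public

faceDim : ∀ {n} → Subset n → ℤ
faceDim σ = + ∣ σ ∣ -ℤ + 1

dim : ∀ {n} → SimplicialComplex n → ℤ
dim {n} K = foldr (λ σ m → if′ isFace K σ then faceDim σ ⊔ℤ m else m) -[1+ 0 ] (allSubsets n)
  where
  if′_then_else_ : Bool → ℤ → ℤ → ℤ
  if′ true then a else b = a
  if′ false then a else b = b

image : ∀ {n} → (Fin n → Fin n) → Subset n → Subset n
image {n} f σ = tabulate (λ v → any (λ u → lookup σ u ∧ ⌊ f u ≟ v ⌋) (allFin n))

module _ {c ℓ : Level} (G : Group c ℓ) where
  open Group G

  FiniteGroup : Set (c ⊔ ℓ)
  FiniteGroup = Σ (List Carrier) λ xs → ∀ g → Any (g ≈_) xs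

  record Action (n : ℕ) : Set (c ⊔ ℓ) where
    field
      act      : Carrier → Fin n → Fin n
      act-ε    : ∀ v → act ε v ≡ v
      act-∙    : ∀ g h v → act (g ∙ h) v ≡ act g (act h v)
      act-resp : ∀ {g h} → g ≈ h → ∀ v → act g v ≡ act h v
  open Action public

  module _ {n : ℕ} (K : SimplicialComplex n) (A : Action n) where

    BySimplicialAutomorphisms : Set c
    BySimplicialAutomorphisms =
      ∀ g σ → isFace K σ ≡ true → isFace K (image (act A g) σ) ≡ true

    -- k is the number of G-orbits of vertices: o : Fin n → Fin k is a
    -- surjection whose fibres are exactly the orbits
    NumberOfVertexOrbits : ℕ → Set c
    NumberOfVertexOrbits k =
      Σ (Fin n → Fin k) λ o →
        (∀ i → ∃ λ v → o v ≡ i) ×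
        (∀ v w → (o v ≡ o w) ⇔ (∃ λ g → act A g v ≡ w))

    Translative : Set c
    Translative =
      ∀ g σ → isFace K σ ≡ true →
        (∃ λ τ → isFace K τ ≡ true × σ ⊆ τ × image (act A g) σ ⊆ τ) →
        image (act A g) σ ≡ σ

{-# OPTIONS --safe #-}
-- A face of dimension at least k has more than k vertices, so with only k vertex orbits
-- it contains two distinct vertices u and v = g u of one orbit. That face then contains
-- both the face {u} and its translate {v} ≠ {u}, which translativity forbids.
module Submission where

open import Defs
open import Level using (Level)
open import Data.Nat using (ℕ)
open import Data.Integer using (+_; _≤_)
open import Relation.Nullary using (¬_)
open import Algebra.Bundles using (Group)

open import Data.Bool using (true; false; _∧_)
open import Data.Bool.ListAction using (any)
open import Data.Bool.Properties using (T-≡; T-∧)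
open import Data.Fin using (Fin; zero; suc; _≟_)
open import Data.Fin.Properties using (pigeonhole; <⇒≢; suc-injective)
open import Data.Fin.Subset using (Subset; _∈_; _⊆_; ⁅_⁆; ∣_∣)
open import Data.Fin.Subset.Properties using (x∈⁅x⁆; x∈⁅y⁆⇒x≡y)
open import Data.Integer using (ℤ; -[1+_]; _⊔_; +≤+)
open import Data.Integer.Properties using (⊔-sel)
open import Data.List using ([]; _∷_; foldr; allFin)
open import Data.List.Relation.Unary.Any using (satisfied)
open import Data.List.Relation.Unary.Any.Properties using (any⁻)
import Data.Nat as ℕ
open import Data.Product using (Σ; ∃; ∃₂; _×_; _,_; proj₁; proj₂)
open import Data.Sum using (_⊎_; inj₁; inj₂)
open import Data.Vec using (_∷_; here; there; lookup)
open import Data.Vec.Properties using ([]=⇒lookup; lookup⇒[]=; lookup∘tabulate)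
open import Function.Bundles using (Equivalence)
open import Relation.Binary.PropositionalEquality
open import Relation.Nullary.Decidable using (⌊_⌋; toWitness)

maxFold-witness : ∀ {a p} {A : Set a} {P : A → Set p} {d : A → ℤ} (step : A → ℤ → ℤ) →
  (∀ x m → step x m ≡ m ⊎ (P x × step x m ≡ d x ⊔ m)) →
  ∀ {b z} xs → b ≤ foldr step z xs → b ≤ z ⊎ ∃ λ x → P x × b ≤ d x
maxFold-witness step spec [] b≤z = inj₁ b≤z
maxFold-witness {d = d} step spec {b} {z} (x ∷ xs) b≤ with spec x (foldr step z xs)
... | inj₁ keep = maxFold-witness step spec xs (subst (b ≤_) keep b≤)
... | inj₂ (Px , take) with ⊔-sel (d x) (foldr step z xs)
...   | inj₁ left = inj₂ (x , Px , subst (b ≤_) (trans take left) b≤)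
...   | inj₂ right = maxFold-witness step spec xs (subst (b ≤_) (trans take right) b≤)

<-of-≤-faceDim : ∀ {n k} (σ : Subset n) → + k ≤ faceDim σ → k ℕ.< ∣ σ ∣
<-of-≤-faceDim σ k≤dimσ with ∣ σ ∣
<-of-≤-faceDim σ () | ℕ.zero
<-of-≤-faceDim σ (+≤+ k≤m) | ℕ.suc m = ℕ.s≤s k≤m

module _ {n : ℕ} (K : SimplicialComplex n) where

  -- The step function of the fold defining dim is local to Defs; a Σ with refl names it.
  private
    dim-fold : Σ (Subset n → ℤ → ℤ) λ step → dim K ≡ foldr step -[1+ 0 ] (allSubsets n)
    dim-fold = _ , refl

    dimStep : Subset n → ℤ → ℤ
    dimStep = proj₁ dim-fold

    dimStep-spec : ∀ σ m → dimStep σ m ≡ m ⊎ (isFace K σ ≡ true × dimStep σ m ≡ faceDim σ ⊔ m)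
    dimStep-spec σ m with isFace K σ
    ... | true = inj₂ (refl , refl)
    ... | false = inj₁ refl

  large-face : ∀ {k} → + k ≤ dim K → ∃ λ σ → isFace K σ ≡ true × k ℕ.< ∣ σ ∣
  large-face {k} k≤dim
    with maxFold-witness dimStep dimStep-spec (allSubsets n) (subst (+ k ≤_) (proj₂ dim-fold) k≤dim)
  ... | inj₁ ()
  ... | inj₂ (σ , face , k≤dimσ) = σ , face , <-of-≤-faceDim σ k≤dimσ

element : ∀ {n} (τ : Subset n) → Fin ∣ τ ∣ → Fin n
element (true ∷ τ) zero = zero
element (true ∷ τ) (suc i) = suc (element τ i)
element (false ∷ τ) i = suc (element τ i)

element-∈ : ∀ {n} (τ : Subset n) i → element τ i ∈ τ
element-∈ (true ∷ τ) zero = here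
element-∈ (true ∷ τ) (suc i) = there (element-∈ τ i)
element-∈ (false ∷ τ) i = there (element-∈ τ i)

element-injective : ∀ {n} (τ : Subset n) {i j} → element τ i ≡ element τ j → i ≡ j
element-injective (true ∷ τ) {zero} {zero} _ = refl
element-injective (true ∷ τ) {suc i} {suc j} e = cong suc (element-injective τ (suc-injective e))
element-injective (false ∷ τ) e = element-injective τ (suc-injective e)

subset-pigeonhole : ∀ {n k} (τ : Subset n) → k ℕ.< ∣ τ ∣ → (o : Fin n → Fin k) →
  ∃₂ λ u v → u ∈ τ × v ∈ τ × u ≢ v × o u ≡ o v
subset-pigeonhole τ k<∣τ∣ o with pigeonhole k<∣τ∣ (λ i → o (element τ i))
... | i , j , i<j , oi≡oj =
  element τ i , element τ j , element-∈ τ i , element-∈ τ j ,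
  (λ e → <⇒≢ i<j (element-injective τ e)) , oi≡oj

∈-image⁻ : ∀ {n} (f : Fin n → Fin n) σ {x} → x ∈ image f σ → ∃ λ w → w ∈ σ × f w ≡ x
∈-image⁻ {n} f σ {x} x∈ =
  let w , w∈σ∧fw≡x = satisfied (any⁻ _ (allFin n) (Equivalence.from T-≡ some-preimage))
      w∈σ , fw≡x = Equivalence.to T-∧ w∈σ∧fw≡x
  in w , lookup⇒[]= w σ (Equivalence.to T-≡ w∈σ) , toWitness fw≡x
  where
  some-preimage : any (λ u → lookup σ u ∧ ⌊ f u ≟ x ⌋) (allFin n) ≡ true
  some-preimage = trans (sym (lookup∘tabulate _ x)) ([]=⇒lookup x∈)

∈-image-⁅⁆ : ∀ {n} (f : Fin n → Fin n) u {x} → x ∈ image f ⁅ u ⁆ → f u ≡ x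
∈-image-⁅⁆ f u x∈ with ∈-image⁻ f ⁅ u ⁆ x∈
... | w , w∈ , fw≡x = subst (λ w → f w ≡ _) (x∈⁅y⁆⇒x≡y u w∈) fw≡x

module _ {c ℓ : Level} (G : Group c ℓ) {n : ℕ} (K : SimplicialComplex n) (A : Action G n) where

  translative⇒fixes-in-face : Translative G K A → ∀ {τ u g} →
    isFace K τ ≡ true → u ∈ τ → act A g u ∈ τ → act A g u ≡ u
  translative⇒fixes-in-face translative {τ} {u} {g} face u∈τ gu∈τ =
    ∈-image-⁅⁆ (act A g) u (subst (u ∈_) (sym g⁅u⁆≡⁅u⁆) (x∈⁅x⁆ u))
    where
    g⁅u⁆≡⁅u⁆ : image (act A g) ⁅ u ⁆ ≡ ⁅ u ⁆
    g⁅u⁆≡⁅u⁆ = translative g ⁅ u ⁆ (vertex K u) (τ , face , ⁅u⁆⊆τ , g⁅u⁆⊆τ)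
      where
      ⁅u⁆⊆τ : ⁅ u ⁆ ⊆ τ
      ⁅u⁆⊆τ x∈ = subst (_∈ τ) (sym (x∈⁅y⁆⇒x≡y u x∈)) u∈τ
      g⁅u⁆⊆τ : image (act A g) ⁅ u ⁆ ⊆ τ
      g⁅u⁆⊆τ x∈ = subst (_∈ τ) (∈-image-⁅⁆ (act A g) u x∈) gu∈τ

corollary2p6 : ∀ {c ℓ : Level} (G : Group c ℓ) → FiniteGroup G →
    (n : ℕ) (K : SimplicialComplex n) (A : Action G n) →
    BySimplicialAutomorphisms G K A →
    (k : ℕ) → NumberOfVertexOrbits G K A k →
    + k ≤ dim K →
    ¬ Translative G K A
corollary2p6 G _ n K A _ k (o , _ , sameOrbit) k≤dim translative
  with large-face K k≤dim
... | τ , face , k<∣τ∣ with subset-pigeonhole τ k<∣τ∣ o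
...   | u , v , u∈τ , v∈τ , u≢v , ou≡ov with Equivalence.to (sameOrbit u v) ou≡ov
...     | g , gu≡v =
  u≢v (trans (sym (translative⇒fixes-in-face G K A translative face u∈τ gu∈τ)) gu≡v)
  where
  gu∈τ : act A g u ∈ τ
  gu∈τ = subst (_∈ τ) (sym gu≡v) v∈τ
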